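{- Let $D,A$ be sets and $T\subseteq D^A$. Let $L(i_T):\mathsf{R}(D,A)\to\mathsf{L}(T,\delta)$ be the map $(\alpha,X)\mapsto(\alpha,X\cap T)$ and let $j_T:\mathsf{L}(T,\delta)\to\mathsf{R}(D,A)$ be its adjoint, i.e. the map characterized by $j_T(\beta,Y)\leq(\alpha,X)$ iff $(\beta,Y)\leq L(i_T)(\alpha,X)$. Then for every $(\alpha,X)\in\mathsf{R}(D,A)$, $(\alpha,\overline{X\cap T}^{\alpha})=j_T(L(i_T)(\alpha,X))$. Moreover, the set of elements of the form $(\alpha,\overline{X\cap T}^{\alpha})$, for $\alpha\subseteq A$ and $X\subseteq D^A$, is a complete sub-join-semilattice of $\mathsf{R}(D,A)$.
   Context: For sets $D$ and $A$, $D^A$ is the set of functions $A\to D$ and $\delta(f,g)=\{a\in A\mid f(a)\neq g(a)\}$. For $\alpha\subseteq A$, $X\subseteq D^A$ is $\alpha$-closed if $f\in X$, $\delta(f,g)\subseteq\alpha$ imply $g\in X$; $\overline{X}^{\alpha}=\{g\in D^A\mid\exists f\in X,\ \delta(f,g)\subseteq\alpha\}$. $\mathsf{R}(D,A)$ is the complete lattice of pairs $(\alpha,X)$, $\alpha\subseteq A$, $X\subseteq D^A$ $\alpha$-closed, ordered componentwise, with meets given by componentwise intersection and joins $\bigvee_i(\alpha_i,X_i)=(\bigcup_i\alpha_i,\overline{\bigcup_iX_i}^{\bigcup_i\alpha_i})$. For $T\subseteq D^A$, $\mathsf{L}(T,\delta)$ is the analogous lattice of pairs $(\beta,Y)$ with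 $\beta\subseteq A$, $Y\subseteq T$ closed under: $f\in Y$, $g\in T$, $\delta(f,g)\subseteq\beta$ imply $g\in Y$; ordered componentwise. -}

module Defs where

open import Level using (0ℓ)
open import Data.Product using (Σ; ∃; _×_; _,_; proj₁; proj₂)
open import Data.Sum using (_⊎_; inj₁; inj₂)
open import Relation.Unary using (Pred; _⊆_; _∩_; _∈_)
open import Relation.Binary.PropositionalEquality using (_≡_; trans)

module _ {D A : Set} where

  -- δ(f,g) ⊆ α : outside α, f and g agree
  -- (for every a, either f a = g a or a ∈ α; classically the same as
  --  {a | f a ≠ g a} ⊆ α)
  δ⊆ : Pred A 0ℓ → (A → D) → (A → D) → Set
  δ⊆ α f g = ∀ a → f a ≡ g a ⊎ a ∈ α

  δ⊆-trans : ∀ {α f g h} → δ⊆ α f g → δ⊆ α g h → δ⊆ α f h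
  δ⊆-trans p q a with p a | q a
  ... | inj₁ e₁ | inj₁ e₂ = inj₁ (trans e₁ e₂)
  ... | inj₁ _  | inj₂ m  = inj₂ m
  ... | inj₂ m  | _       = inj₂ m

  δ⊆-mono : ∀ {α β : Pred A 0ℓ} {f g} → α ⊆ β → δ⊆ α f g → δ⊆ β f g
  δ⊆-mono s p a with p a
  ... | inj₁ e = inj₁ e
  ... | inj₂ m = inj₂ (s m)

  IsClosed : Pred A 0ℓ → Pred (A → D) 0ℓ → Set
  IsClosed α X = ∀ {f g} → X f → δ⊆ α f g → X g

  closure : Pred A 0ℓ → Pred (A → D) 0ℓ → Pred (A → D) 0ℓ
  closure α X g = Σ (A → D) λ f → X f × δ⊆ α f g

  closure-closed : ∀ α X → IsClosed α (closure α X)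
  closure-closed α X (f , xf , d) d' = f , xf , δ⊆-trans d d'

record R (D A : Set) : Set₁ where
  constructor mkR
  field
    α      : Pred A 0ℓ
    X      : Pred (A → D) 0ℓ
    closed : IsClosed α X
open R public

_≤R_ : {D A : Set} → R D A → R D A → Set
r ≤R s = (α r ⊆ α s) × (X r ⊆ X s)

_≈R_ : {D A : Set} → R D A → R D A → Set
r ≈R s = (r ≤R s) × (s ≤R r)

⋁R : {D A : Set} {I : Set} → (I → R D A) → R D A
⋁R {I = I} F = mkR α' (closure α' X') (closure-closed α' X')
  where
  α' = λ a → Σ I λ i → α (F i) a
  X' = λ f → Σ I λ i → X (F i) f

record L {D A : Set} (T : Pred (A → D) 0ℓ) : Set₁ where
  constructor mkL
  field
    β        : Pred A 0ℓ
    Y        : Pred (A → D) 0ℓ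
    Y⊆T      : Y ⊆ T
    closedT  : ∀ {f g} → Y f → T g → δ⊆ β f g → Y g
open L public

_≤L_ : {D A : Set} {T : Pred (A → D) 0ℓ} → L T → L T → Set
l ≤L m = (β l ⊆ β m) × (Y l ⊆ Y m)

LiT : {D A : Set} (T : Pred (A → D) 0ℓ) → R D A → L T
LiT T r = mkL (α r) (X r ∩ T) proj₂
  (λ { (xf , _) tg d → closed r xf d , tg })

clT : {D A : Set} (T : Pred (A → D) 0ℓ) → Pred A 0ℓ → Pred (A → D) 0ℓ → R D A
clT T α X = mkR α (closure α (X ∩ T)) (closure-closed α (X ∩ T))

InImage : {D A : Set} (T : Pred (A → D) 0ℓ) → R D A → Set₁
InImage {D} {A} T r = Σ (Pred A 0ℓ) λ α → Σ (Pred (A → D) 0ℓ) λ X → r ≈R clT T α X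

-- Closing X ∩ T under α is the least α-closed set containing X ∩ T, which is
-- exactly what the universal property of the left adjoint j_T produces from
-- L(i_T)(α, X).  An element (α, X) lies in the image of the closure operator
-- precisely when X ⊆ (X ∩ T)‾α, i.e. when it is generated by its points in T;
-- this property visibly survives joins, since the closure of a union of
-- generated sets is generated by the union of their generators.
module Submission where

open import Defs
open import Level using (0ℓ)
open import Function using (id)
open import Data.Product using (_×_; _,_; proj₁; proj₂)
open import Data.Sum using (inj₁)
open import Relation.Unary using (Pred; _⊆_; _∩_)
open import Relation.Binary.PropositionalEquality using (refl)

module _ {D A : Set} where

  δ⊆-refl : ∀ {α : Pred A 0ℓ} {f : A → D} → δ⊆ α f f
  δ⊆-refl a = inj₁ refl

  ⊆-closure : ∀ {α : Pred A 0ℓ} {X : Pred (A → D) 0ℓ} → X ⊆ closure α X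
  ⊆-closure {x = f} xf = f , xf , δ⊆-refl

  closure-least : ∀ {α β : Pred A 0ℓ} {X Y : Pred (A → D) 0ℓ}
    → IsClosed β Y → α ⊆ β → X ⊆ Y → closure α X ⊆ Y
  closure-least Y-closed α⊆β X⊆Y (f , xf , d) = Y-closed (X⊆Y xf) (δ⊆-mono α⊆β d)

  closure-mono : ∀ {α β : Pred A 0ℓ} {X Y : Pred (A → D) 0ℓ}
    → α ⊆ β → X ⊆ Y → closure α X ⊆ closure β Y
  closure-mono {β = β} {Y = Y} α⊆β X⊆Y =
    closure-least (closure-closed β Y) α⊆β (λ xf → ⊆-closure (X⊆Y xf))

IsLeftAdjointOfLiT : {D A : Set} (T : Pred (A → D) 0ℓ) → (L T → R D A) → Set₁
IsLeftAdjointOfLiT T j =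
  ∀ (l : L T) (r : R _ _) → (j l ≤R r → l ≤L LiT T r) × (l ≤L LiT T r → j l ≤R r)

leftAdjoint∘LiT≈clT : {D A : Set} (T : Pred (A → D) 0ℓ) (j : L T → R D A)
  → IsLeftAdjointOfLiT T j → ∀ (r : R D A) → clT T (α r) (X r) ≈R j (LiT T r)
leftAdjoint∘LiT≈clT T j adj r = clT≤j , j≤clT
  where
  unit : LiT T r ≤L LiT T (j (LiT T r))
  unit = proj₁ (adj (LiT T r) (j (LiT T r))) (id , id)

  clT≤j : clT T (α r) (X r) ≤R j (LiT T r)
  clT≤j = proj₁ unit
        , closure-least (closed (j (LiT T r))) (proj₁ unit) (λ xt → proj₁ (proj₂ unit xt))

  j≤clT : j (LiT T r) ≤R clT T (α r) (X r)
  j≤clT = proj₂ (adj (LiT T r) (clT T (α r) (X r)))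
            (id , (λ xt → ⊆-closure xt , proj₂ xt))

GeneratedBy : {D A : Set} (T : Pred (A → D) 0ℓ) → R D A → Set
GeneratedBy T r = X r ⊆ closure (α r) (X r ∩ T)

InImage⇒GeneratedBy : {D A : Set} (T : Pred (A → D) 0ℓ) (r : R D A)
  → InImage T r → GeneratedBy T r
InImage⇒GeneratedBy T r (α₀ , _ , (_ , X⊆cl) , (α₀⊆α , cl⊆X)) xf =
  closure-mono α₀⊆α (λ xt → cl⊆X (⊆-closure xt) , proj₂ xt) (X⊆cl xf)

GeneratedBy⇒InImage : {D A : Set} (T : Pred (A → D) 0ℓ) (r : R D A)
  → GeneratedBy T r → InImage T r
GeneratedBy⇒InImage T r gen =
  α r , X r , (id , gen) , (id , closure-least (closed r) id proj₁)

⋁R-GeneratedBy : {D A I : Set} (T : Pred (A → D) 0ℓ) (F : I → R D A)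
  → (∀ i → GeneratedBy T (F i)) → GeneratedBy T (⋁R F)
⋁R-GeneratedBy T F gen =
  closure-least (closure-closed _ _) id
    (λ { (i , xf) → closure-mono (i ,_) (λ { (xg , tg) → ⊆-closure (i , xg) , tg }) (gen i xf) })

mainTheorem2 : {D A : Set} (T : Pred (A → D) 0ℓ)
    → ((j : L T → R D A)
       → (∀ (l : L T) (r : R D A) → (j l ≤R r → l ≤L LiT T r) × (l ≤L LiT T r → j l ≤R r))
       → ∀ (r : R D A) → clT T (α r) (X r) ≈R j (LiT T r))
    × (∀ {I : Set} (F : I → R D A) → (∀ i → InImage T (F i)) → InImage T (⋁R F))
mainTheorem2 T =
    leftAdjoint∘LiT≈clT T
  , λ F inImage → GeneratedBy⇒InImage T (⋁R F)
                    (⋁R-GeneratedBy T F (λ i → InImage⇒GeneratedBy T (F i) (inImage i)))
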